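{- Let $\mathcal H$ and $\mathcal K$ be orientably regular hypermaps with hypermap subgroups $H$ and $K$ such that $\mathcal K$ is totally chiral and $\mathcal K$ covers $\mathcal H$ (i.e. $K\leq H$). Then the oriented direct product $\mathcal L=\mathcal K\times\mathcal H^r$ is defined and is an orientably regular hypermap, and its chirality group satisfies $X(\mathcal L)\cong H/K$.
   Context: Let $\Delta=\langle r_0,r_1,r_2\mid r_0^2=r_1^2=r_2^2=1\rangle$ and let $\Delta^+$ be its index-$2$ subgroup of even-length words, generated by $\rho=r_1r_2$ and $\lambda=r_2r_0$. An (oriented) hypermap is a triple $(D,R,L)$ with $D$ a finite set and $R,L$ permutations of $D$ such that $\langle R,L\rangle$ (the monodromy group) is transitive on $D$. It is orientably regular if its automorphism group (permutations of $D$ commuting with $R$ and $L$) acts regularly on $D$; then it is isomorphic to $(\Delta^+/H,\rho,\lambda)$ (left multiplication on cosets) for a unique normal subgroup $H$ of finite index in $\Delta^+$ (the hypermap subgroup), and $\Delta^+$ acts on $D$ via $\rho\mapsto R,\lambda\mapsto L$. For $H\trianglelefteq\Delta^+$ put $H^r=r_2Hr_2$; the mirror image $\mathcal H^r=(D,R^{ -1},L^{ -1})$ of $\mathcal H=(D,R,L)$ has hypermap subgroup $H^r$. The chirality group is $X(\mathcal H)=HH^r/H$ (isomorphic to $H/(H\cap H^r)$); $\mathcal H$ is totally chiral if $HH^r=\Delta^+$. For hypermaps $(D_1,R_1,L_1)$, $(D_2,R_2,L_2)$, if the action of $\Delta^+$ on $D_1\times D_2$ given by $R(x,y)=(R_1x,R_2y)$,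 $L(x,y)=(L_1x,L_2y)$ is transitive, the oriented direct product is the hypermap $(D_1\times D_2,R,L)$. -}

module Defs where

open import Data.Bool using (Bool; true; false; not)
open import Data.Nat using (ℕ)
open import Data.Fin using (Fin)
open import Data.Product using (Σ; Σ-syntax; _×_; _,_; ∃)
open import Data.List using (List; []; _∷_; _++_; map; reverse)
open import Function.Bundles using (_↔_; Inverse)
open import Function.Properties.Inverse using (↔-sym)
open import Data.Product.Function.NonDependent.Propositional using (_×-↔_)
open import Relation.Binary.PropositionalEquality using (_≡_)

-- The group Δ⁺ : free on ρ = r₁r₂ and λ = r₂r₀.  Elements are represented
-- by words in ρ^{±1}, λ^{±1}; subgroups are represented by predicates on
-- words that are invariant under free reduction (all the predicates below
-- are defined through an action, hence are invariant).

data Gen : Set where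
  rho lam : Gen

-- (g , true) = g, (g , false) = g⁻¹
Letter : Set
Letter = Gen × Bool

Word : Set
Word = List Letter

invL : Letter → Letter
invL (g , b) = (g , not b)

inv : Word → Word
inv w = reverse (map invL w)

-- conjugation by r₂ : ρ ↦ ρ⁻¹ , λ ↦ λ⁻¹ (letterwise, order kept)
flipW : Word → Word
flipW w = map invL w

record Triple : Set₁ where
  field
    D    : Set
    R    : D ↔ D
    L    : D ↔ D
    base : D

open Triple public

genAct : (T : Triple) → Letter → D T → D T
genAct T (rho , true)  = Inverse.to   (R T)
genAct T (rho , false) = Inverse.from (R T)
genAct T (lam , true)  = Inverse.to   (L T)
genAct T (lam , false) = Inverse.from (L T)

act : (T : Triple) → Word → D T → D T
act T []      x = x
act T (a ∷ w) x = genAct T a (act T w x)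

IsFinite : Triple → Set
IsFinite T = Σ ℕ λ n → D T ↔ Fin n

IsTransitive : Triple → Set
IsTransitive T = ∀ (x y : D T) → Σ Word λ w → act T w x ≡ y

IsHypermap : Triple → Set
IsHypermap T = IsFinite T × IsTransitive T

IsAutomorphism : (T : Triple) → D T ↔ D T → Set
IsAutomorphism T σ =
  (∀ x → Inverse.to σ (Inverse.to (R T) x) ≡ Inverse.to (R T) (Inverse.to σ x)) ×
  (∀ x → Inverse.to σ (Inverse.to (L T) x) ≡ Inverse.to (L T) (Inverse.to σ x))

IsOrientablyRegular : Triple → Set
IsOrientablyRegular T =
  IsHypermap T ×
  (∀ (x y : D T) → Σ (D T ↔ D T) λ σ → IsAutomorphism T σ × Inverse.to σ x ≡ y) ×
  (∀ (σ : D T ↔ D T) → IsAutomorphism T σ →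
     ∀ x → Inverse.to σ x ≡ x → ∀ y → Inverse.to σ y ≡ y)

-- Hypermap subgroup (for an orientably regular hypermap: the stabiliser
-- of a dart, which is the same for every dart), its mirror H^r = r₂ H r₂,
-- and products of subgroups.

HSub : (T : Triple) → Word → Set
HSub T w = act T w (base T) ≡ base T

HrSub : (T : Triple) → Word → Set
HrSub T w = HSub T (flipW w)

-- w ∈ A B   iff   w = a b with a ∈ A, b ∈ B   (b = a⁻¹ w)
InProd : (Word → Set) → (Word → Set) → Word → Set
InProd A B w = Σ Word λ a → A a × B (inv a ++ w)

TotallyChiral : Triple → Set
TotallyChiral T = ∀ w → InProd (HSub T) (HrSub T) w

Covers : Triple → Triple → Set
Covers K H = ∀ w → HSub K w → HSub H w

-- Mirror image and oriented direct product (as triples; whether the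
-- product is a hypermap, i.e. transitive, is a separate statement).

mirror : Triple → Triple
mirror T = record { D = D T ; R = ↔-sym (R T) ; L = ↔-sym (L T) ; base = base T }

oprod : Triple → Triple → Triple
oprod T U = record
  { D    = D T × D U
  ; R    = R T ×-↔ R U
  ; L    = L T ×-↔ L U
  ; base = (base T , base U) }

-- Elements of A/N_A are words u ∈ A, with u ~ v iff u⁻¹v ∈ N_A;
-- multiplication is concatenation.

record QuotIso (A NA B NB : Word → Set) : Set where
  field
    f      : (u : Word) → A u → Word
    f-in   : ∀ u (p : A u) → B (f u p)
    f-cong : ∀ u v (p : A u) (q : A v) → NA (inv u ++ v) → NB (inv (f u p) ++ f v q)
    f-hom  : ∀ u v (p : A u) (q : A v) (r : A (u ++ v)) →
               NB (inv (f (u ++ v) r) ++ (f u p ++ f v q))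
    f-inj  : ∀ u v (p : A u) (q : A v) → NB (inv (f u p) ++ f v q) → NA (inv u ++ v)
    f-surj : ∀ y → B y → Σ Word λ u → Σ (A u) λ p → NB (inv (f u p) ++ y)

ChiralityIso : Triple → (Word → Set) → (Word → Set) → Set
ChiralityIso T B NB = QuotIso (InProd (HSub T) (HrSub T)) (HSub T) B NB

{-# OPTIONS --safe #-}
module Submission where

-- Write K, H for the hypermap subgroups of 𝓚, 𝓗, so that 𝓗ʳ has subgroup Hʳ
-- and Kʳ ≤ Hʳ.  Total chirality K Kʳ = Δ⁺ then gives K Hʳ = Δ⁺, which is
-- exactly transitivity of Δ⁺ on the product 𝓛 = 𝓚 × 𝓗ʳ; darts and
-- automorphisms being pairs, 𝓛 is regular with subgroup L = K ∩ Hʳ, and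
-- Lʳ = Kʳ ∩ H.  Every u ∈ L Lʳ factors as u = a b with a ∈ L, b ∈ Lʳ ⊆ H,
-- and u ↦ b = a⁻¹ u induces L Lʳ / L ≅ H / K: since K ⊴ Δ⁺ and a ∈ K, b acts
-- on 𝓚 as u does.  It is injective because L Lʳ ⊆ Hʳ (as Lʳ ⊆ Kʳ ≤ Hʳ), so
-- u ≡ v mod K already gives u⁻¹ v ∈ K ∩ Hʳ = L; it is onto because y ∈ H
-- factors as y = a c with a ∈ K ≤ H, c ∈ Kʳ, hence c = a⁻¹ y ∈ Kʳ ∩ H = Lʳ.

open import Defs
open import Data.Product using (Σ; _×_; _,_; proj₁; proj₂)
open import Data.Product.Properties using (,-injective)
open import Data.Product.Function.NonDependent.Propositional using (_×-↔_)
open import Data.Bool using (true; false)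
open import Data.List using ([]; _∷_; _++_; map; reverse)
open import Data.List.Properties using (unfold-reverse; reverse-map; reverse-involutive)
open import Data.Nat using (_*_)
open import Data.Fin.Properties using (*↔×)
open import Function.Bundles using (_↔_; Inverse)
open import Function.Properties.Inverse using (↔-sym; ↔-trans)
open import Relation.Binary.PropositionalEquality
open ≡-Reasoning

open Inverse using (to; from; strictlyInverseˡ; strictlyInverseʳ)

invL-involutive : ∀ a → invL (invL a) ≡ a
invL-involutive (_ , true)  = refl
invL-involutive (_ , false) = refl

flipW-involutive : ∀ w → flipW (flipW w) ≡ w
flipW-involutive []      = refl
flipW-involutive (a ∷ w) = cong₂ _∷_ (invL-involutive a) (flipW-involutive w)

inv-involutive : ∀ w → inv (inv w) ≡ w
inv-involutive w = begin
  reverse (map invL (reverse (flipW w))) ≡⟨ cong reverse (reverse-map invL (flipW w)) ⟩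
  reverse (reverse (flipW (flipW w)))    ≡⟨ reverse-involutive _ ⟩
  flipW (flipW w)                        ≡⟨ flipW-involutive w ⟩
  w                                      ∎

inv-∷ : ∀ a w → inv (a ∷ w) ≡ inv w ++ invL a ∷ []
inv-∷ a w = unfold-reverse (invL a) (flipW w)

commute-from : {A : Set} (σ f : A ↔ A) →
  (∀ x → to σ (to f x) ≡ to f (to σ x)) → ∀ x → to σ (from f x) ≡ from f (to σ x)
commute-from σ f comm x = begin
  to σ (from f x)                   ≡⟨ strictlyInverseʳ f _ ⟨
  from f (to f (to σ (from f x)))   ≡⟨ cong (from f) (comm (from f x)) ⟨
  from f (to σ (to f (from f x)))   ≡⟨ cong (λ y → from f (to σ y)) (strictlyInverseˡ f x) ⟩
  from f (to σ x)                   ∎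

module _ (T : Triple) where

  act-++ : ∀ u v x → act T (u ++ v) x ≡ act T u (act T v x)
  act-++ []      v x = refl
  act-++ (a ∷ u) v x = cong (genAct T a) (act-++ u v x)

  genAct-invL-cancelˡ : ∀ a x → genAct T (invL a) (genAct T a x) ≡ x
  genAct-invL-cancelˡ (rho , true)  = strictlyInverseʳ (R T)
  genAct-invL-cancelˡ (rho , false) = strictlyInverseˡ (R T)
  genAct-invL-cancelˡ (lam , true)  = strictlyInverseʳ (L T)
  genAct-invL-cancelˡ (lam , false) = strictlyInverseˡ (L T)

  act-inv-cancelˡ : ∀ u x → act T (inv u) (act T u x) ≡ x
  act-inv-cancelˡ []      x = refl
  act-inv-cancelˡ (a ∷ u) x = begin
    act T (inv (a ∷ u)) (genAct T a (act T u x))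
      ≡⟨ cong (λ w → act T w (genAct T a (act T u x))) (inv-∷ a u) ⟩
    act T (inv u ++ invL a ∷ []) (genAct T a (act T u x))
      ≡⟨ act-++ (inv u) _ _ ⟩
    act T (inv u) (genAct T (invL a) (genAct T a (act T u x)))
      ≡⟨ cong (act T (inv u)) (genAct-invL-cancelˡ a _) ⟩
    act T (inv u) (act T u x)
      ≡⟨ act-inv-cancelˡ u x ⟩
    x ∎

  act-inv-cancelʳ : ∀ u x → act T u (act T (inv u) x) ≡ x
  act-inv-cancelʳ u x =
    subst (λ w → act T w (act T (inv u) x) ≡ x) (inv-involutive u) (act-inv-cancelˡ (inv u) x)

  act-inv-++⁻ : ∀ u v {x y} → act T (inv u ++ v) x ≡ y → act T v x ≡ act T u y
  act-inv-++⁻ u v {x} {y} h = begin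
    act T v x                           ≡⟨ act-inv-cancelʳ u _ ⟨
    act T u (act T (inv u) (act T v x)) ≡⟨ cong (act T u) (act-++ (inv u) v x) ⟨
    act T u (act T (inv u ++ v) x)      ≡⟨ cong (act T u) h ⟩
    act T u y                           ∎

  act-inv-++⁺ : ∀ u v {x y} → act T v x ≡ act T u y → act T (inv u ++ v) x ≡ y
  act-inv-++⁺ u v {x} {y} h = begin
    act T (inv u ++ v) x      ≡⟨ act-++ (inv u) v x ⟩
    act T (inv u) (act T v x) ≡⟨ cong (act T (inv u)) h ⟩
    act T (inv u) (act T u y) ≡⟨ act-inv-cancelˡ u y ⟩
    y                         ∎

  reachable⇒isTransitive : (∀ y → Σ Word λ w → act T w (base T) ≡ y) → IsTransitive T
  reachable⇒isTransitive reach x y with reach x | reach y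
  ... | u , refl | v , refl = v ++ inv u , (begin
    act T (v ++ inv u) (act T u (base T))       ≡⟨ act-++ v (inv u) _ ⟩
    act T v (act T (inv u) (act T u (base T))) ≡⟨ cong (act T v) (act-inv-cancelˡ u _) ⟩
    act T v (base T)                            ∎)

  automorphism-genAct : ∀ σ → IsAutomorphism T σ →
    ∀ a x → to σ (genAct T a x) ≡ genAct T a (to σ x)
  automorphism-genAct σ (commR , commL) (rho , true)  = commR
  automorphism-genAct σ (commR , commL) (rho , false) = commute-from σ (R T) commR
  automorphism-genAct σ (commR , commL) (lam , true)  = commL
  automorphism-genAct σ (commR , commL) (lam , false) = commute-from σ (L T) commL

  automorphism-act : ∀ σ → IsAutomorphism T σ →
    ∀ w x → to σ (act T w x) ≡ act T w (to σ x)
  automorphism-act σ aut []      x = refl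
  automorphism-act σ aut (a ∷ w) x =
    trans (automorphism-genAct σ aut a _) (cong (genAct T a) (automorphism-act σ aut w x))

  automorphism-fixing-dart⇒identity : IsTransitive T → ∀ σ → IsAutomorphism T σ →
    ∀ x → to σ x ≡ x → ∀ y → to σ y ≡ y
  automorphism-fixing-dart⇒identity transitive σ aut x σx≡x y with transitive x y
  ... | w , refl = trans (automorphism-act σ aut w x) (cong (act T w) σx≡x)

  -- Regularity makes the stabiliser of the base dart normal: it is the kernel of the action.
  stabiliser-acts-trivially : IsOrientablyRegular T →
    ∀ a → HSub T a → ∀ y → act T a y ≡ y
  stabiliser-acts-trivially (_ , autTransitive , _) a a∈H y with autTransitive (base T) y
  ... | σ , aut , refl = begin
    act T a (to σ (base T)) ≡⟨ automorphism-act σ aut a _ ⟨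
    to σ (act T a (base T)) ≡⟨ cong (to σ) a∈H ⟩
    to σ (base T)           ∎

  drop-stabiliser : IsOrientablyRegular T →
    ∀ a → HSub T a → ∀ u y → act T (inv a ++ u) y ≡ act T u y
  drop-stabiliser regular a a∈H u y =
    act-inv-++⁺ a u (sym (stabiliser-acts-trivially regular a a∈H (act T u y)))

module _ (T : Triple) where

  act-mirror : ∀ w x → act (mirror T) w x ≡ act T (flipW w) x
  act-mirror []                x = refl
  act-mirror ((rho , true) ∷ w)  x = cong (from (R T)) (act-mirror w x)
  act-mirror ((rho , false) ∷ w) x = cong (to (R T)) (act-mirror w x)
  act-mirror ((lam , true) ∷ w)  x = cong (from (L T)) (act-mirror w x)
  act-mirror ((lam , false) ∷ w) x = cong (to (L T)) (act-mirror w x)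

  HSub-mirror⁺ : ∀ w → HrSub T w → HSub (mirror T) w
  HSub-mirror⁺ w = trans (act-mirror w (base T))

  HSub-mirror⁻ : ∀ w → HSub (mirror T) w → HrSub T w
  HSub-mirror⁻ w = trans (sym (act-mirror w (base T)))

  HrSub-mirror⁺ : ∀ w → HSub T w → HrSub (mirror T) w
  HrSub-mirror⁺ w w∈H = HSub-mirror⁺ (flipW w) (subst (HSub T) (sym (flipW-involutive w)) w∈H)

  HrSub-mirror⁻ : ∀ w → HrSub (mirror T) w → HSub T w
  HrSub-mirror⁻ w w∈Hʳʳ = subst (HSub T) (flipW-involutive w) (HSub-mirror⁻ (flipW w) w∈Hʳʳ)

  mirror-isTransitive : IsTransitive T → IsTransitive (mirror T)
  mirror-isTransitive transitive x y with transitive x y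
  ... | w , wx≡y = flipW w ,
    trans (act-mirror (flipW w) x) (trans (cong (λ v → act T v x) (flipW-involutive w)) wx≡y)

  mirror-automorphism : ∀ σ → IsAutomorphism T σ → IsAutomorphism (mirror T) σ
  mirror-automorphism σ (commR , commL) =
    commute-from σ (R T) commR , commute-from σ (L T) commL

  mirror-isOrientablyRegular : IsOrientablyRegular T → IsOrientablyRegular (mirror T)
  mirror-isOrientablyRegular ((finite , transitive) , autTransitive , _) =
    (finite , transitiveʳ) ,
    (λ x y → let σ , aut , σx≡y = autTransitive x y
             in σ , mirror-automorphism σ aut , σx≡y) ,
    automorphism-fixing-dart⇒identity (mirror T) transitiveʳ
    where
    transitiveʳ = mirror-isTransitive transitive

module _ (T U : Triple) where

  genAct-oprod : ∀ a x y → genAct (oprod T U) a (x , y) ≡ (genAct T a x , genAct U a y)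
  genAct-oprod (rho , true)  x y = refl
  genAct-oprod (rho , false) x y = refl
  genAct-oprod (lam , true)  x y = refl
  genAct-oprod (lam , false) x y = refl

  act-oprod : ∀ w x y → act (oprod T U) w (x , y) ≡ (act T w x , act U w y)
  act-oprod []      x y = refl
  act-oprod (a ∷ w) x y =
    trans (cong (genAct (oprod T U) a) (act-oprod w x y)) (genAct-oprod a _ _)

  HSub-oprod⁺ : ∀ w → HSub T w → HSub U w → HSub (oprod T U) w
  HSub-oprod⁺ w w∈T w∈U = trans (act-oprod w (base T) (base U)) (cong₂ _,_ w∈T w∈U)

  HSub-oprod⁻ : ∀ w → HSub (oprod T U) w → HSub T w × HSub U w
  HSub-oprod⁻ w w∈TU = ,-injective (trans (sym (act-oprod w (base T) (base U))) w∈TU)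

  oprod-isFinite : IsFinite T → IsFinite U → IsFinite (oprod T U)
  oprod-isFinite (m , T≅m) (n , U≅n) = m * n , ↔-trans (T≅m ×-↔ U≅n) (↔-sym (*↔× {m} {n}))

  oprod-automorphism : ∀ σ τ → IsAutomorphism T σ → IsAutomorphism U τ →
    IsAutomorphism (oprod T U) (σ ×-↔ τ)
  oprod-automorphism σ τ (σR , σL) (τR , τL) =
    (λ (x , y) → cong₂ _,_ (σR x) (τR y)) , (λ (x , y) → cong₂ _,_ (σL x) (τL y))

  oprod-isTransitive : IsTransitive T → IsTransitive U →
    (∀ w → InProd (HSub T) (HSub U) w) → IsTransitive (oprod T U)
  oprod-isTransitive transitiveT transitiveU factor = reachable⇒isTransitive (oprod T U) reach
    where
    reach : ∀ p → Σ Word λ w → act (oprod T U) w (base T , base U) ≡ p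
    reach (x , y) with transitiveT (base T) x | transitiveU (base U) y
    ... | u , refl | v , refl with factor (inv u ++ v)
    ... | k , k∈T , k⁻¹u⁻¹v∈U =
      u ++ k , trans (act-oprod (u ++ k) _ _) (cong₂ _,_ onT onU)
      where
      onT : act T (u ++ k) (base T) ≡ act T u (base T)
      onT = trans (act-++ T u k _) (cong (act T u) k∈T)
      onU : act U (u ++ k) (base U) ≡ act U v (base U)
      onU = trans (act-++ U u k _)
        (sym (act-inv-++⁻ U u v (act-inv-++⁻ U k (inv u ++ v) k⁻¹u⁻¹v∈U)))

  oprod-isOrientablyRegular : IsOrientablyRegular T → IsOrientablyRegular U →
    IsTransitive (oprod T U) → IsOrientablyRegular (oprod T U)
  oprod-isOrientablyRegular ((finT , _) , autTransT , _) ((finU , _) , autTransU , _) transitive =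
    (oprod-isFinite finT finU , transitive) ,
    autTransitive ,
    automorphism-fixing-dart⇒identity (oprod T U) transitive
    where
    autTransitive : ∀ p q → Σ (D (oprod T U) ↔ D (oprod T U)) λ σ →
      IsAutomorphism (oprod T U) σ × to σ p ≡ q
    autTransitive (x , y) (x′ , y′) with autTransT x x′ | autTransU y y′
    ... | σ , σ-aut , σx≡x′ | τ , τ-aut , τy≡y′ =
      (σ ×-↔ τ) , oprod-automorphism σ τ σ-aut τ-aut , cong₂ _,_ σx≡x′ τy≡y′

module _ (𝓗 𝓚 : Triple) (regularH : IsOrientablyRegular 𝓗) (regularK : IsOrientablyRegular 𝓚)
         (totallyChiral : TotallyChiral 𝓚) (K≤H : Covers 𝓚 𝓗) where

  private
    𝓗ʳ : Triple
    𝓗ʳ = mirror 𝓗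

    𝓛 : Triple
    𝓛 = oprod 𝓚 𝓗ʳ

    LLʳ : Word → Set
    LLʳ = InProd (HSub 𝓛) (HrSub 𝓛)

    regularHʳ : IsOrientablyRegular 𝓗ʳ
    regularHʳ = mirror-isOrientablyRegular 𝓗 regularH

    Kʳ≤Hʳ : ∀ w → HrSub 𝓚 w → HSub 𝓗ʳ w
    Kʳ≤Hʳ w w∈Kʳ = HSub-mirror⁺ 𝓗 w (K≤H (flipW w) w∈Kʳ)

    L⊆K : ∀ w → HSub 𝓛 w → HSub 𝓚 w
    L⊆K w w∈L = proj₁ (HSub-oprod⁻ 𝓚 𝓗ʳ w w∈L)

    L⊆Hʳ : ∀ w → HSub 𝓛 w → HSub 𝓗ʳ w
    L⊆Hʳ w w∈L = proj₂ (HSub-oprod⁻ 𝓚 𝓗ʳ w w∈L)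

    Lʳ⊆Kʳ : ∀ w → HrSub 𝓛 w → HrSub 𝓚 w
    Lʳ⊆Kʳ w w∈Lʳ = proj₁ (HSub-oprod⁻ 𝓚 𝓗ʳ (flipW w) w∈Lʳ)

    Lʳ⊆H : ∀ w → HrSub 𝓛 w → HSub 𝓗 w
    Lʳ⊆H w w∈Lʳ = HrSub-mirror⁻ 𝓗 w (proj₂ (HSub-oprod⁻ 𝓚 𝓗ʳ (flipW w) w∈Lʳ))

    Kʳ∩H⊆Lʳ : ∀ w → HrSub 𝓚 w → HSub 𝓗 w → HrSub 𝓛 w
    Kʳ∩H⊆Lʳ w w∈Kʳ w∈H = HSub-oprod⁺ 𝓚 𝓗ʳ (flipW w) w∈Kʳ (HrSub-mirror⁺ 𝓗 w w∈H)

    K·Hʳ≡Δ⁺ : ∀ w → InProd (HSub 𝓚) (HSub 𝓗ʳ) w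
    K·Hʳ≡Δ⁺ w with totallyChiral w
    ... | a , a∈K , a⁻¹w∈Kʳ = a , a∈K , Kʳ≤Hʳ (inv a ++ w) a⁻¹w∈Kʳ

  oprod-mirror-isTransitive : IsTransitive 𝓛
  oprod-mirror-isTransitive = oprod-isTransitive 𝓚 𝓗ʳ
    (proj₂ (proj₁ regularK)) (proj₂ (proj₁ regularHʳ)) K·Hʳ≡Δ⁺

  oprod-mirror-isOrientablyRegular : IsOrientablyRegular 𝓛
  oprod-mirror-isOrientablyRegular =
    oprod-isOrientablyRegular 𝓚 𝓗ʳ regularK regularHʳ oprod-mirror-isTransitive

  private
    f : ∀ u → LLʳ u → Word
    f u (a , _) = inv a ++ u

    f-act-𝓚 : ∀ u p y → act 𝓚 (f u p) y ≡ act 𝓚 u y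
    f-act-𝓚 u (a , a∈L , _) = drop-stabiliser 𝓚 regularK a (L⊆K a a∈L) u

    LLʳ⊆Hʳ : ∀ u → LLʳ u → HSub 𝓗ʳ u
    LLʳ⊆Hʳ u (a , a∈L , a⁻¹u∈Lʳ) = begin
      act 𝓗ʳ u (base 𝓗)            ≡⟨ drop-stabiliser 𝓗ʳ regularHʳ a (L⊆Hʳ a a∈L) u _ ⟨
      act 𝓗ʳ (inv a ++ u) (base 𝓗) ≡⟨ Kʳ≤Hʳ (inv a ++ u) (Lʳ⊆Kʳ (inv a ++ u) a⁻¹u∈Lʳ) ⟩
      base 𝓗                       ∎

    f-in : ∀ u p → HSub 𝓗 (f u p)
    f-in u (a , _ , a⁻¹u∈Lʳ) = Lʳ⊆H (inv a ++ u) a⁻¹u∈Lʳ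

    f-cong : ∀ u v p q → HSub 𝓛 (inv u ++ v) → HSub 𝓚 (inv (f u p) ++ f v q)
    f-cong u v p q u⁻¹v∈L = act-inv-++⁺ 𝓚 (f u p) (f v q) (begin
      act 𝓚 (f v q) (base 𝓚) ≡⟨ f-act-𝓚 v q _ ⟩
      act 𝓚 v (base 𝓚)       ≡⟨ act-inv-++⁻ 𝓚 u v (L⊆K (inv u ++ v) u⁻¹v∈L) ⟩
      act 𝓚 u (base 𝓚)       ≡⟨ f-act-𝓚 u p _ ⟨
      act 𝓚 (f u p) (base 𝓚) ∎)

    f-hom : ∀ u v p q r → HSub 𝓚 (inv (f (u ++ v) r) ++ (f u p ++ f v q))
    f-hom u v p q r = act-inv-++⁺ 𝓚 (f (u ++ v) r) (f u p ++ f v q) (begin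
      act 𝓚 (f u p ++ f v q) (base 𝓚)        ≡⟨ act-++ 𝓚 (f u p) (f v q) _ ⟩
      act 𝓚 (f u p) (act 𝓚 (f v q) (base 𝓚)) ≡⟨ f-act-𝓚 u p _ ⟩
      act 𝓚 u (act 𝓚 (f v q) (base 𝓚))       ≡⟨ cong (act 𝓚 u) (f-act-𝓚 v q _) ⟩
      act 𝓚 u (act 𝓚 v (base 𝓚))             ≡⟨ act-++ 𝓚 u v _ ⟨
      act 𝓚 (u ++ v) (base 𝓚)                ≡⟨ f-act-𝓚 (u ++ v) r _ ⟨
      act 𝓚 (f (u ++ v) r) (base 𝓚)          ∎)

    f-inj : ∀ u v p q → HSub 𝓚 (inv (f u p) ++ f v q) → HSub 𝓛 (inv u ++ v)
    f-inj u v p q fu⁻¹fv∈K = HSub-oprod⁺ 𝓚 𝓗ʳ (inv u ++ v)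
      (act-inv-++⁺ 𝓚 u v (begin
        act 𝓚 v (base 𝓚)       ≡⟨ f-act-𝓚 v q _ ⟨
        act 𝓚 (f v q) (base 𝓚) ≡⟨ act-inv-++⁻ 𝓚 (f u p) (f v q) fu⁻¹fv∈K ⟩
        act 𝓚 (f u p) (base 𝓚) ≡⟨ f-act-𝓚 u p _ ⟩
        act 𝓚 u (base 𝓚)       ∎))
      (act-inv-++⁺ 𝓗ʳ u v (trans (LLʳ⊆Hʳ v q) (sym (LLʳ⊆Hʳ u p))))

    f-surj : ∀ y → HSub 𝓗 y → Σ Word λ u → Σ (LLʳ u) λ p → HSub 𝓚 (inv (f u p) ++ y)
    f-surj y y∈H with totallyChiral y
    ... | a , a∈K , a⁻¹y∈Kʳ =
      inv a ++ y ,
      ([] , refl , Kʳ∩H⊆Lʳ (inv a ++ y) a⁻¹y∈Kʳ a⁻¹y∈H) ,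
      act-inv-++⁺ 𝓚 (inv a ++ y) y (sym (drop-stabiliser 𝓚 regularK a a∈K y _))
      where
      a⁻¹y∈H : HSub 𝓗 (inv a ++ y)
      a⁻¹y∈H = trans (drop-stabiliser 𝓗 regularH a (K≤H a a∈K) y _) y∈H

  oprod-mirror-chiralityIso : ChiralityIso 𝓛 (HSub 𝓗) (HSub 𝓚)
  oprod-mirror-chiralityIso = record
    { f = f ; f-in = f-in ; f-cong = f-cong ; f-hom = f-hom ; f-inj = f-inj ; f-surj = f-surj }

proposition16 : (𝓗 𝓚 : Triple) →
    IsOrientablyRegular 𝓗 → IsOrientablyRegular 𝓚 →
    TotallyChiral 𝓚 → Covers 𝓚 𝓗 →
    IsHypermap (oprod 𝓚 (mirror 𝓗)) ×
    IsOrientablyRegular (oprod 𝓚 (mirror 𝓗)) ×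
    ChiralityIso (oprod 𝓚 (mirror 𝓗)) (HSub 𝓗) (HSub 𝓚)
proposition16 𝓗 𝓚 regularH regularK totallyChiral K≤H =
  proj₁ regular , regular , oprod-mirror-chiralityIso 𝓗 𝓚 regularH regularK totallyChiral K≤H
  where
  regular : IsOrientablyRegular (oprod 𝓚 (mirror 𝓗))
  regular = oprod-mirror-isOrientablyRegular 𝓗 𝓚 regularH regularK totallyChiral K≤H
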